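{- For every integer $n\ge1$, the Hilbert basis of the lecture hall cone $L_n$ (i.e., the unique minimal generating set of the semigroup $L_n\cap\mathbb{Z}^n$) is \[ \mathcal{H}_n=\{v_A : A\subseteq\{1,2,\ldots,n-1\}\}. \]
   Context: $L_n:=\{\lambda\in\mathbb{R}^n : 0\le \frac{\lambda_1}{1}\le\frac{\lambda_2}{2}\le\cdots\le\frac{\lambda_n}{n}\}$. For $A=\{i_1<i_2<\cdots<i_k\}\subseteq\{1,\ldots,n-1\}$, $v_A\in\mathbb{Z}^n$ is the vector $v_A=(0,\ldots,0,i_1,i_2,\ldots,i_k,i_k+1)$ (the last $k+1$ coordinates are $i_1,\ldots,i_k,i_k+1$ and the first $n-k-1$ coordinates are $0$); for $A=\emptyset$ this means $v_\emptyset=(0,\ldots,0,1)$. -}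

module Defs where

open import Level using (0ℓ)
open import Data.Bool using (Bool; true; false)
open import Data.Nat using (ℕ; zero; suc; _∸_)
open import Data.Fin using (Fin; toℕ)
open import Data.Fin.Subset using (Subset)
open import Data.Integer using (ℤ; +_) renaming (_+_ to _+ℤ_)
open import Data.Rational using (ℚ; _/_; _≤_; 0ℚ)
open import Data.List using (List; []; _∷_; _++_; length; replicate; map)
open import Data.Vec using (Vec; lookup; tabulate; zipWith)
open import Data.Product using (_×_; ∃)
open import Relation.Binary.PropositionalEquality using (_≡_)
open import Relation.Unary using (Pred; _⊆_)

-- the rational number λ_i / i  (1-based index i = toℕ i' + 1)
ratio : ∀ {n} → Vec ℤ n → Fin n → ℚ
ratio v i = lookup v i / suc (toℕ i)

LHpoint : (n : ℕ) → Pred (Vec ℤ n) 0ℓ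
LHpoint n v =
  (∀ (i : Fin n) → toℕ i ≡ 0 → 0ℚ ≤ ratio v i) ×
  (∀ (i j : Fin n) → toℕ j ≡ suc (toℕ i) → ratio v i ≤ ratio v j)

zeroV : ∀ {n} → Vec ℤ n
zeroV = tabulate (λ _ → + 0)

_⊕_ : ∀ {n} → Vec ℤ n → Vec ℤ n → Vec ℤ n
_⊕_ = zipWith _+ℤ_

data Gen {n : ℕ} (H : Pred (Vec ℤ n) 0ℓ) : Pred (Vec ℤ n) 0ℓ where
  gen-zero : Gen H zeroV
  gen-add  : ∀ {h w} → H h → Gen H w → Gen H (h ⊕ w)

IsGeneratingSet : ∀ {n} → Pred (Vec ℤ n) 0ℓ → Pred (Vec ℤ n) 0ℓ → Set
IsGeneratingSet S H = (H ⊆ S) × (S ⊆ Gen H)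

IsMinimalGeneratingSet : ∀ {n} → Pred (Vec ℤ n) 0ℓ → Pred (Vec ℤ n) 0ℓ → Set₁
IsMinimalGeneratingSet S H =
  IsGeneratingSet S H × (∀ (G : Pred _ 0ℓ) → G ⊆ H → IsGeneratingSet S G → H ⊆ G)

-- A ⊆ {1,…,m} encoded as Subset m (position j ↦ element j+1);
-- elements listed in increasing order
elemsFrom : ∀ {m} → ℕ → Subset m → List ℕ
elemsFrom k Data.Vec.[] = []
elemsFrom k (true Data.Vec.∷ p) = k ∷ elemsFrom (suc k) p
elemsFrom k (false Data.Vec.∷ p) = elemsFrom (suc k) p

elems : ∀ {m} → Subset m → List ℕ
elems = elemsFrom 1

lastOr : ℕ → List ℕ → ℕ
lastOr d [] = d
lastOr d (x ∷ xs) = lastOr x xs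

nthOr0 : List ℤ → ℕ → ℤ
nthOr0 [] _ = + 0
nthOr0 (x ∷ xs) zero = x
nthOr0 (x ∷ xs) (suc k) = nthOr0 xs k

-- v_A as a list: (0,…,0,i₁,…,i_k,i_k+1), of length m+1
vAList : ∀ {m} → Subset m → List ℤ
vAList {m} A = map +_ (replicate (m ∸ length es) 0 ++ es ++ (suc (lastOr 0 es) ∷ []))
  where es = elems A

-- v_A ∈ ℤ^(m+1) for A ⊆ {1,…,m}  (here n = m+1)
vA : ∀ {m} → Subset m → Vec ℤ (suc m)
vA A = tabulate (λ i → nthOr0 (vAList A) (toℕ i))

Hset : (m : ℕ) → Pred (Vec ℤ (suc m)) 0ℓ
Hset m v = ∃ λ (A : Subset m) → v ≡ vA A

module Submission where

-- Write a lattice point of the cone as a sequence g₀, g₁, … of naturals with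
-- (p+2) gₚ ≤ (p+1) gₚ₊₁. The first k coordinates are a sum of ⌈g_{k−1}/k⌉ partial
-- generators (0,…,0,i₁,…,iⱼ) with 0 < i₁ < ⋯ < iⱼ ≤ k: the inequality gives
-- ⌈g_{k−1}/k⌉ ≤ ⌈gₖ/(k+1)⌉ and g_{k−1} + ⌈gₖ/(k+1)⌉ ≤ gₖ ≤ (k+1)⌈gₖ/(k+1)⌉, which is
-- exactly the room needed to give every part one more entry. At the last coordinate
-- the number of parts is raised to the rise g_{n−1} − g_{n−2}, and each part is closed
-- by its last entry plus one; these are the vectors v_A. Conversely, the rise is
-- additive, nonnegative on the cone, zero only at 0 and equal to 1 on every v_A, so no
-- v_A is a sum of other nonzero lattice points, and every generating set contains ℋₙ.

open import Defs
open import Level using (0ℓ)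
open import Function using (_∘_)
open import Data.Empty using (⊥-elim)
open import Data.Unit using (⊤; tt)
open import Data.Bool using (true; false)
open import Data.Product using (Σ; ∃; _×_; _,_; proj₁; proj₂)
open import Data.Sum using (_⊎_; inj₁; inj₂)
open import Data.Nat hiding (_/_)
open import Data.Nat.Properties
open import Algebra.Properties.CommutativeSemigroup +-commutativeSemigroup using (interchange)
open import Data.List using (List; []; _∷_; _++_; length; replicate; map)
open import Data.List.Properties using (length-++; length-replicate; length-map; ++-assoc; ++-identityʳ)
open import Data.List.Relation.Unary.All as All using (All; []; _∷_)
import Data.List.Relation.Unary.All.Properties as All
open import Data.Fin using (Fin; toℕ; fromℕ<)
import Data.Fin as Fin
open import Data.Fin.Properties using (toℕ-fromℕ<; toℕ<n)
open import Data.Fin.Subset using (Subset)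
open import Data.Vec using (Vec; []; _∷_; lookup; tabulate)
open import Data.Vec.Properties using (lookup∘tabulate; tabulate∘lookup; tabulate-cong)
open import Data.Integer as ℤ using (ℤ)
import Data.Integer.Properties as ℤ
import Data.Integer.Tactic.RingSolver as ℤSolver
import Data.Rational as ℚ
import Data.Rational.Properties as ℚ
import Data.Rational.Unnormalised as ℚᵘ
import Data.Rational.Unnormalised.Properties as ℚᵘ
open import Relation.Nullary using (yes; no)
open import Relation.Unary using (Pred; _⊆_)
open import Relation.Binary.PropositionalEquality

-- Ceilings and the lecture hall inequalities

infix 4 _≡⌈_/_⌉

_≡⌈_/_⌉ : ℕ → ℕ → ℕ → Set
N ≡⌈ a / r ⌉ = a ≤ r * N × r * N < a + r

⌈/⌉-exists : ∀ a d → ∃ λ N → N ≡⌈ a / suc d ⌉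
⌈/⌉-exists zero d = 0 , z≤n , subst (_< suc d) (sym (*-zeroʳ d)) z<s
⌈/⌉-exists (suc a) d with ⌈/⌉-exists a d
... | N , a≤ , <a+ with suc a ≤? suc d * N
...   | yes a<  = N , a< , <-trans <a+ (n<1+n _)
...   | no  a≮ = suc N , a+1≤ , <a+1+
  where
  exact : suc d * N ≡ a
  exact = ≤-antisym (≤-pred (≰⇒> a≮)) a≤
  next : suc d * suc N ≡ suc d + a
  next = trans (*-suc (suc d) N) (cong (suc d +_) exact)
  a+1≤ : suc a ≤ suc d * suc N
  a+1≤ = subst (suc a ≤_) (sym next) (+-monoˡ-≤ a (s≤s z≤n))
  <a+1+ : suc d * suc N < suc a + suc d
  <a+1+ = subst (_< suc a + suc d) (sym (trans next (+-comm (suc d) a))) ≤-refl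

⌈/⌉-least : ∀ {a d N M} → N ≡⌈ a / suc d ⌉ → a ≤ suc d * M → N ≤ M
⌈/⌉-least {a} {d} {N} {M} (_ , dN<) a≤dM with N ≤? M
... | yes N≤M = N≤M
... | no  N≰M = ⊥-elim (<-irrefl refl (begin-strict
      suc d * M + suc d  ≡⟨ +-comm (suc d * M) (suc d) ⟩
      suc d + suc d * M  ≡⟨ *-suc (suc d) M ⟨
      suc d * suc M      ≤⟨ *-monoʳ-≤ (suc d) (≰⇒> N≰M) ⟩
      suc d * N          <⟨ dN< ⟩
      a + suc d          ≤⟨ +-monoˡ-≤ (suc d) a≤dM ⟩
      suc d * M + suc d  ∎))
  where open ≤-Reasoning

record IsLectureHall (n : ℕ) (g : ℕ → ℕ) : Set where
  field
    ratio-≤ : ∀ p → suc p < n → suc (suc p) * g p ≤ suc p * g (suc p)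
open IsLectureHall

module _ {n g} (lh′ : IsLectureHall n g) {p} (p< : suc p < n) where
  open ≤-Reasoning

  private
    a b : ℕ
    a = g p
    b = g (suc p)
    lh : suc (suc p) * a ≤ suc p * b
    lh = ratio-≤ lh′ p p<

  lh-mono : g p ≤ g (suc p)
  lh-mono = *-cancelˡ-≤ (suc p) (≤-trans (m≤n+m (suc p * a) a) lh)

  -- with b = a + d the inequality (p+2) a ≤ (p+1) b says exactly a ≤ (p+1) d
  lh-gapˡ : g p ≤ suc p * (g (suc p) ∸ g p)
  lh-gapˡ = +-cancelˡ-≤ (suc p * a) a (suc p * (b ∸ a)) (begin
    suc p * a + a              ≡⟨ +-comm (suc p * a) a ⟩
    suc (suc p) * a            ≤⟨ lh ⟩
    suc p * b                  ≡⟨ cong (suc p *_) (m+[n∸m]≡n lh-mono) ⟨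
    suc p * (a + (b ∸ a))      ≡⟨ *-distribˡ-+ (suc p) a (b ∸ a) ⟩
    suc p * a + suc p * (b ∸ a) ∎)

  lh-gapʳ : g (suc p) ≤ suc (suc p) * (g (suc p) ∸ g p)
  lh-gapʳ = begin
    b                          ≡⟨ m+[n∸m]≡n lh-mono ⟨
    a + (b ∸ a)                ≤⟨ +-monoˡ-≤ (b ∸ a) lh-gapˡ ⟩
    suc p * (b ∸ a) + (b ∸ a)  ≡⟨ +-comm (suc p * (b ∸ a)) (b ∸ a) ⟩
    suc (suc p) * (b ∸ a)      ∎

  lh-bound : ∀ {N} → g (suc p) ≤ suc (suc p) * N → g p ≤ suc p * N
  lh-bound {N} b≤ = *-cancelˡ-≤ (suc (suc p)) (begin
    suc (suc p) * a            ≤⟨ lh ⟩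
    suc p * b                  ≤⟨ *-monoʳ-≤ (suc p) b≤ ⟩
    suc p * (suc (suc p) * N)  ≡⟨ *-assoc (suc p) (suc (suc p)) N ⟨
    suc p * suc (suc p) * N    ≡⟨ cong (_* N) (*-comm (suc p) (suc (suc p))) ⟩
    suc (suc p) * suc p * N    ≡⟨ *-assoc (suc (suc p)) (suc p) N ⟩
    suc (suc p) * (suc p * N)  ∎)

lh-restrict : ∀ {n g} → IsLectureHall (suc n) g → IsLectureHall n g
lh-restrict lh .ratio-≤ p p< = ratio-≤ lh p (m<n⇒m<1+n p<)

lh-monotone : ∀ {n g p q} → IsLectureHall n g → p ≤ q → q < n → g p ≤ g q
lh-monotone {q = zero}  lh z≤n _  = ≤-refl
lh-monotone {q = suc q} lh p≤ q< with m≤n⇒m<n∨m≡n p≤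
... | inj₂ refl      = ≤-refl
... | inj₁ (s≤s p≤q) = ≤-trans (lh-monotone lh p≤q (<⇒≤ q<)) (lh-mono lh q<)

rise : ℕ → (ℕ → ℕ) → ℕ
rise zero    g = g 0
rise (suc k) g = g (suc k) ∸ g k

rise≡0⇒top≡0 : ∀ m {g} → IsLectureHall (suc m) g → rise m g ≡ 0 → g m ≡ 0
rise≡0⇒top≡0 zero        _  r≡0 = r≡0
rise≡0⇒top≡0 (suc k) {g} lh r≡0 =
  n≤0⇒n≡0 (subst (g (suc k) ≤_) (trans (cong (suc (suc k) *_) r≡0) (*-zeroʳ (suc (suc k)))) (lh-gapʳ lh ≤-refl))

-- Lists of naturals

∑ : {A : Set} → List A → (A → ℕ) → ℕ
∑ []       f = 0
∑ (x ∷ xs) f = f x + ∑ xs f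

syntax ∑ xs (λ x → e) = ∑[ x ∈ xs ] e

module _ {A : Set} where

  ∑-++ : ∀ (f : A → ℕ) xs ys → ∑ (xs ++ ys) f ≡ ∑ xs f + ∑ ys f
  ∑-++ f []       ys = refl
  ∑-++ f (x ∷ xs) ys = trans (cong (f x +_) (∑-++ f xs ys)) (sym (+-assoc (f x) _ _))

  ∑-+ : ∀ (f g : A → ℕ) xs → ∑[ x ∈ xs ] (f x + g x) ≡ ∑ xs f + ∑ xs g
  ∑-+ f g []       = refl
  ∑-+ f g (x ∷ xs) = trans (cong (f x + g x +_) (∑-+ f g xs)) (interchange (f x) (g x) (∑ xs f) (∑ xs g))

  ∑-const : ∀ c (xs : List A) → ∑[ x ∈ xs ] c ≡ length xs * c
  ∑-const c []       = refl
  ∑-const c (x ∷ xs) = cong (c +_) (∑-const c xs)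

  ∑-replicate : ∀ (f : A → ℕ) n x → ∑ (replicate n x) f ≡ n * f x
  ∑-replicate f zero    x = refl
  ∑-replicate f (suc n) x = cong (f x +_) (∑-replicate f n x)

  ∑-cong : ∀ {f g : A → ℕ} {xs} → All (λ x → f x ≡ g x) xs → ∑ xs f ≡ ∑ xs g
  ∑-cong []         = refl
  ∑-cong (eq ∷ eqs) = cong₂ _+_ eq (∑-cong eqs)

  ∑-map : ∀ {B : Set} (f : B → ℕ) (h : A → B) xs → ∑ (map h xs) f ≡ ∑[ x ∈ xs ] f (h x)
  ∑-map f h []       = refl
  ∑-map f h (x ∷ xs) = cong (f (h x) +_) (∑-map f h xs)

nth : List ℕ → ℕ → ℕ
nth []       _       = 0
nth (x ∷ xs) zero    = x
nth (x ∷ xs) (suc p) = nth xs p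

nth-++ˡ : ∀ xs ys {p} → p < length xs → nth (xs ++ ys) p ≡ nth xs p
nth-++ˡ (x ∷ xs) ys {zero}  _       = refl
nth-++ˡ (x ∷ xs) ys {suc p} (s≤s p<) = nth-++ˡ xs ys p<

nth-++ʳ : ∀ xs ys p → nth (xs ++ ys) (length xs + p) ≡ nth ys p
nth-++ʳ []       ys p = refl
nth-++ʳ (x ∷ xs) ys p = nth-++ʳ xs ys p

nth-replicate-0 : ∀ r p → nth (replicate r 0) p ≡ 0
nth-replicate-0 zero    p       = refl
nth-replicate-0 (suc r) zero    = refl
nth-replicate-0 (suc r) (suc p) = nth-replicate-0 r p

nth-snoc-< : ∀ {k} xs x {p} → length xs ≡ k → p < k → nth (xs ++ x ∷ []) p ≡ nth xs p
nth-snoc-< xs x refl p< = nth-++ˡ xs _ p<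

nth-snoc-≡ : ∀ {k} xs x → length xs ≡ k → nth (xs ++ x ∷ []) k ≡ x
nth-snoc-≡ xs x refl = trans (cong (nth (xs ++ _)) (sym (+-identityʳ (length xs)))) (nth-++ʳ xs _ 0)

nth-pred-length : ∀ xs → nth xs (pred (length xs)) ≡ lastOr 0 xs
nth-pred-length []       = refl
nth-pred-length (x ∷ xs) = go x xs
  where
  go : ∀ x xs → nth (x ∷ xs) (length xs) ≡ lastOr x xs
  go x []       = refl
  go x (y ∷ ys) = go y ys

lastOr-++ : ∀ d xs ys → lastOr d (xs ++ ys) ≡ lastOr (lastOr d xs) ys
lastOr-++ d []       ys = refl
lastOr-++ d (x ∷ xs) ys = lastOr-++ x xs ys

lastOr-replicate : ∀ r → lastOr 0 (replicate r 0) ≡ 0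
lastOr-replicate zero    = refl
lastOr-replicate (suc r) = lastOr-replicate r

Ascending : ℕ → ℕ → List ℕ → Set
Ascending lo B []       = ⊤
Ascending lo B (x ∷ xs) = lo < x × x ≤ B × Ascending x B xs

asc-length : ∀ {lo B} es → Ascending lo B es → lo ≤ B → length es + lo ≤ B
asc-length []       _              lo≤B = lo≤B
asc-length (x ∷ xs) (lo<x , x≤B , asc) _ =
  ≤-trans (subst (_≤ length xs + x) (+-suc (length xs) _) (+-monoʳ-≤ (length xs) lo<x))
          (asc-length xs asc x≤B)

asc-length₀ : ∀ {B} es → Ascending 0 B es → length es ≤ B
asc-length₀ es asc = subst (_≤ _) (+-identityʳ (length es)) (asc-length es asc z≤n)

asc-lastOr : ∀ {lo B} es → Ascending lo B es → lo ≤ B → lastOr lo es ≤ B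
asc-lastOr []       _              lo≤B = lo≤B
asc-lastOr (x ∷ xs) (_ , x≤B , asc) _   = asc-lastOr xs asc x≤B

asc-lastOr-lower : ∀ {x B} xs → Ascending x B xs → x + length xs ≤ lastOr x xs
asc-lastOr-lower {x} []       _              = ≤-reflexive (+-identityʳ x)
asc-lastOr-lower {x} (y ∷ ys) (x<y , _ , asc) =
  ≤-trans (subst (_≤ y + length ys) (sym (+-suc x (length ys))) (+-monoˡ-≤ (length ys) x<y))
          (asc-lastOr-lower ys asc)

asc-snoc : ∀ {lo B x} es → Ascending lo B es → lastOr lo es < x → x ≤ B → Ascending lo B (es ++ x ∷ [])
asc-snoc []       _             lst<x x≤B = lst<x , x≤B , tt
asc-snoc (y ∷ ys) (lo<y , y≤B , asc) lst<x x≤B = lo<y , y≤B , asc-snoc ys asc lst<x x≤B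

asc-mono-bound : ∀ {lo B B′} es → B ≤ B′ → Ascending lo B es → Ascending lo B′ es
asc-mono-bound []       _    _                   = tt
asc-mono-bound (x ∷ xs) B≤B′ (lo<x , x≤B , asc) = lo<x , ≤-trans x≤B B≤B′ , asc-mono-bound xs B≤B′ asc

asc-mono-lower : ∀ {lo lo′ B} es → lo ≤ lo′ → Ascending lo′ B es → Ascending lo B es
asc-mono-lower []       _      _                  = tt
asc-mono-lower (x ∷ xs) lo≤lo′ (lo′<x , x≤B , asc) = ≤-trans (s≤s lo≤lo′) lo′<x , x≤B , asc

pad : ℕ → List ℕ → List ℕ
pad k es = replicate (k ∸ length es) 0 ++ es

-- vAList A is map ℤ.+_ (gen m (elems A)), definitionally
gen : ℕ → List ℕ → List ℕ
gen m es = replicate (m ∸ length es) 0 ++ es ++ suc (lastOr 0 es) ∷ []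

length-pad : ∀ {k} es → length es ≤ k → length (pad k es) ≡ k
length-pad {k} es ≤k = begin
  length (pad k es)                                ≡⟨ length-++ (replicate (k ∸ length es) 0) ⟩
  length (replicate (k ∸ length es) 0) + length es ≡⟨ cong (_+ length es) (length-replicate (k ∸ length es)) ⟩
  k ∸ length es + length es                        ≡⟨ m∸n+n≡m ≤k ⟩
  k                                                ∎
  where open ≡-Reasoning

nth-pad-[] : ∀ k p → nth (pad k []) p ≡ 0
nth-pad-[] k p = trans (cong (λ xs → nth xs p) (++-identityʳ (replicate k 0))) (nth-replicate-0 k p)

nth-pad-last : ∀ {k} es → length es ≤ suc k → nth (pad (suc k) es) k ≡ lastOr 0 es
nth-pad-last {k} es ≤k = begin
  nth (pad (suc k) es) k                            ≡⟨ cong (nth (pad (suc k) es)) (cong pred (length-pad es ≤k)) ⟨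
  nth (pad (suc k) es) (pred (length (pad (suc k) es))) ≡⟨ nth-pred-length (pad (suc k) es) ⟩
  lastOr 0 (pad (suc k) es)                         ≡⟨ lastOr-++ 0 (replicate (suc k ∸ length es) 0) es ⟩
  lastOr (lastOr 0 (replicate (suc k ∸ length es) 0)) es ≡⟨ cong (λ d → lastOr d es) (lastOr-replicate (suc k ∸ length es)) ⟩
  lastOr 0 es                                       ∎
  where open ≡-Reasoning

pad-snoc : ∀ k es x → pad (suc k) (es ++ x ∷ []) ≡ pad k es ++ x ∷ []
pad-snoc k es x = begin
  replicate (suc k ∸ length (es ++ x ∷ [])) 0 ++ es ++ x ∷ []
    ≡⟨ cong (λ r → replicate (suc k ∸ r) 0 ++ es ++ x ∷ []) (trans (length-++ es) (+-comm (length es) 1)) ⟩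
  replicate (k ∸ length es) 0 ++ es ++ x ∷ []                 ≡⟨ ++-assoc (replicate (k ∸ length es) 0) es _ ⟨
  pad k es ++ x ∷ []                                           ∎
  where open ≡-Reasoning

nth-pad-snoc-< : ∀ {k p} es x → length es ≤ k → p < k → nth (pad (suc k) (es ++ x ∷ [])) p ≡ nth (pad k es) p
nth-pad-snoc-< {k} es x ≤k p< =
  trans (cong (λ xs → nth xs _) (pad-snoc k es x)) (nth-snoc-< (pad k es) x (length-pad es ≤k) p<)

nth-pad-snoc-top : ∀ {k} es x → length es ≤ k → nth (pad (suc k) (es ++ x ∷ [])) k ≡ x
nth-pad-snoc-top {k} es x ≤k =
  trans (cong (λ xs → nth xs k) (pad-snoc k es x)) (nth-snoc-≡ (pad k es) x (length-pad es ≤k))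

gen≡pad : ∀ m es → gen m es ≡ pad (suc m) (es ++ suc (lastOr 0 es) ∷ [])
gen≡pad m es = trans (sym (++-assoc (replicate (m ∸ length es) 0) es _)) (sym (pad-snoc m es _))

nth-gen-< : ∀ {m es p} → Ascending 0 m es → p < m → nth (gen m es) p ≡ nth (pad m es) p
nth-gen-< {m} {es} asc p< = trans (cong (λ xs → nth xs _) (gen≡pad m es)) (nth-pad-snoc-< es _ (asc-length₀ es asc) p<)

nth-gen-top : ∀ {m es} → Ascending 0 m es → nth (gen m es) m ≡ suc (lastOr 0 es)
nth-gen-top {m} {es} asc = trans (cong (λ xs → nth xs m) (gen≡pad m es)) (nth-pad-snoc-top es _ (asc-length₀ es asc))

-- Decomposition into generators

asc-extend : ∀ {k d} es → Ascending 0 (suc k) es → d ≤ suc k ∸ lastOr 0 es →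
  Ascending 0 (suc (suc k)) (es ++ d + suc (lastOr 0 es) ∷ [])
asc-extend {k} {d} es asc d≤ =
  asc-snoc es (asc-mono-bound es (n≤1+n (suc k)) asc) (m≤n+m (suc (lastOr 0 es)) d) (begin
    d + suc (lastOr 0 es)                       ≤⟨ +-monoˡ-≤ (suc (lastOr 0 es)) d≤ ⟩
    suc k ∸ lastOr 0 es + suc (lastOr 0 es)     ≡⟨ +-suc (suc k ∸ lastOr 0 es) (lastOr 0 es) ⟩
    suc (suc k ∸ lastOr 0 es + lastOr 0 es)     ≡⟨ cong suc (m∸n+n≡m (asc-lastOr es asc z≤n)) ⟩
    suc (suc k)                                 ∎)
  where open ≤-Reasoning

distribute : ∀ {A : Set} (cap : A → ℕ) xs {e} → e ≤ ∑ xs cap →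
  Σ (List (A × ℕ)) λ ys → map proj₁ ys ≡ xs × All (λ y → proj₂ y ≤ cap (proj₁ y)) ys × ∑ ys proj₂ ≡ e
distribute cap []       {zero} _ = [] , refl , [] , refl
distribute cap (x ∷ xs) {e}    e≤ with e ≤? cap x
... | yes e≤cap with distribute cap xs {0} z≤n
...   | ys , xs≡ , caps , sum≡ = (x , e) ∷ ys , cong (x ∷_) xs≡ , e≤cap ∷ caps , trans (cong (e +_) sum≡) (+-identityʳ e)
distribute cap (x ∷ xs) {e} e≤ | no e≰cap with distribute cap xs {e ∸ cap x} (m≤n+o⇒m∸n≤o e (cap x) e≤)
...   | ys , xs≡ , caps , sum≡ =
  (x , cap x) ∷ ys , cong (x ∷_) xs≡ , ≤-refl ∷ caps , trans (cong (cap x +_) sum≡) (m+[n∸m]≡n (<⇒≤ (≰⇒> e≰cap)))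

record Parts (k N : ℕ) (g : ℕ → ℕ) : Set where
  field
    parts     : List (List ℕ)
    ascending : All (Ascending 0 k) parts
    count     : length parts ≡ N
    sums      : ∀ p → p < k → g p ≡ ∑[ es ∈ parts ] nth (pad k es) p

module _ {k N : ℕ} {g : ℕ → ℕ} (P : Parts (suc k) N g) where
  open Parts P

  ∑-lastOr : ∑[ es ∈ parts ] lastOr 0 es ≡ g k
  ∑-lastOr = sym (trans (sums k ≤-refl)
    (∑-cong (All.map (λ {es} asc → nth-pad-last es (asc-length₀ es asc)) ascending)))

  ∑-suc-lastOr : ∑[ es ∈ parts ] suc (lastOr 0 es) ≡ N + g k
  ∑-suc-lastOr = trans (∑-+ (λ _ → 1) (lastOr 0) parts)
    (cong₂ _+_ (trans (∑-const 1 parts) (trans (*-identityʳ _) count)) ∑-lastOr)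

  ∑-room : ∑[ es ∈ parts ] (suc (lastOr 0 es) + (suc k ∸ lastOr 0 es)) ≡ N * suc (suc k)
  ∑-room = trans (∑-cong (All.map (λ {es} asc → cong suc (m+[n∸m]≡n (asc-lastOr es asc z≤n))) ascending))
                 (trans (∑-const (suc (suc k)) parts) (cong (_* suc (suc k)) count))

parts-pad : ∀ {k N′ N g} → Parts k N′ g → N′ ≤ N → Parts k N g
parts-pad {k} {N′} {N} {g} P N′≤N = record
  { parts     = parts ++ replicate (N ∸ N′) []
  ; ascending = All.++⁺ ascending (All.replicate⁺ (N ∸ N′) tt)
  ; count     = trans (length-++ parts) (trans (cong₂ _+_ count (length-replicate (N ∸ N′))) (m+[n∸m]≡n N′≤N))
  ; sums      = λ p p<k → trans (sums p p<k) (sym (begin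
      ∑[ es ∈ parts ++ replicate (N ∸ N′) [] ] nth (pad k es) p   ≡⟨ ∑-++ (λ es → nth (pad k es) p) parts _ ⟩
      ∑[ es ∈ parts ] nth (pad k es) p + ∑[ es ∈ replicate (N ∸ N′) [] ] nth (pad k es) p
        ≡⟨ cong (_ +_) (trans (∑-replicate (λ es → nth (pad k es) p) (N ∸ N′) [])
                              (trans (cong ((N ∸ N′) *_) (nth-pad-[] k p)) (*-zeroʳ (N ∸ N′)))) ⟩
      ∑[ es ∈ parts ] nth (pad k es) p + 0                         ≡⟨ +-identityʳ _ ⟩
      ∑[ es ∈ parts ] nth (pad k es) p                             ∎))
  }
  where
  open Parts P
  open ≡-Reasoning

-- Every part es gets a new last entry d + suc (lastOr 0 es) ≤ k + 2: the surplus
-- g (k+1) − (g k + N) is spread over the parts with d ≤ k + 1 − lastOr 0 es.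
parts-extend : ∀ {k N g} → Parts (suc k) N g →
  g k + N ≤ g (suc k) → g (suc k) ≤ suc (suc k) * N → Parts (suc (suc k)) N g
parts-extend {k} {N} {g} P low high = record
  { parts     = map extend ys
  ; ascending = All.map⁺ (All.map (λ { {es , _} (asc , d≤) → asc-extend es asc d≤ }) parts-rooms)
  ; count     = trans (length-map extend ys) (trans (sym (length-map proj₁ ys)) (trans (cong length ys≡) count))
  ; sums      = sums′
  }
  where
  open Parts P

  room : List ℕ → ℕ
  room es = suc k ∸ lastOr 0 es

  surplus≤ : g (suc k) ∸ (g k + N) ≤ ∑ parts room
  surplus≤ = m≤n+o⇒m∸n≤o (g (suc k)) (g k + N) (begin
    g (suc k)                                            ≤⟨ high ⟩
    suc (suc k) * N                                      ≡⟨ *-comm (suc (suc k)) N ⟩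
    N * suc (suc k)                                      ≡⟨ ∑-room P ⟨
    ∑[ es ∈ parts ] (suc (lastOr 0 es) + room es)        ≡⟨ ∑-+ (λ es → suc (lastOr 0 es)) room parts ⟩
    ∑[ es ∈ parts ] suc (lastOr 0 es) + ∑ parts room     ≡⟨ cong (_+ ∑ parts room) (trans (∑-suc-lastOr P) (+-comm N (g k))) ⟩
    g k + N + ∑ parts room                               ∎)
    where open ≤-Reasoning

  distributed = distribute room parts surplus≤
  ys  = proj₁ distributed
  ys≡ = proj₁ (proj₂ distributed)

  extend : List ℕ × ℕ → List ℕ
  extend (es , d) = es ++ d + suc (lastOr 0 es) ∷ []

  parts-rooms : All (λ y → Ascending 0 (suc k) (proj₁ y) × proj₂ y ≤ room (proj₁ y)) ys
  parts-rooms = All.zip (All.map⁻ (subst (All (Ascending 0 (suc k))) (sym ys≡) ascending) , proj₁ (proj₂ (proj₂ distributed)))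

  ∑-extend : ∀ (f : List ℕ → ℕ) (h : List ℕ × ℕ → ℕ) →
    (∀ {y} → Ascending 0 (suc k) (proj₁ y) → f (extend y) ≡ h y) → ∑ (map extend ys) f ≡ ∑ ys h
  ∑-extend f h eq = trans (∑-map f extend ys) (∑-cong (All.map (λ {y} asc×d → eq {y} (proj₁ asc×d)) parts-rooms))

  ∑-parts : ∀ (f : List ℕ → ℕ) → ∑[ y ∈ ys ] f (proj₁ y) ≡ ∑ parts f
  ∑-parts f = trans (sym (∑-map f proj₁ ys)) (cong (λ xs → ∑ xs f) ys≡)

  sums′ : ∀ p → p < suc (suc k) → g p ≡ ∑[ es ∈ map extend ys ] nth (pad (suc (suc k)) es) p
  sums′ p p< with m<1+n⇒m<n∨m≡n p<
  ... | inj₁ p<k = begin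
    g p                                                        ≡⟨ sums p p<k ⟩
    ∑[ es ∈ parts ] nth (pad (suc k) es) p                     ≡⟨ ∑-parts (λ es → nth (pad (suc k) es) p) ⟨
    ∑[ y ∈ ys ] nth (pad (suc k) (proj₁ y)) p                  ≡⟨ ∑-extend _ _ (λ {(es , _)} asc → nth-pad-snoc-< es _ (asc-length₀ es asc) p<k) ⟨
    ∑[ es ∈ map extend ys ] nth (pad (suc (suc k)) es) p       ∎
    where open ≡-Reasoning
  ... | inj₂ refl = begin
    g (suc k)                                                  ≡⟨ m∸n+n≡m low ⟨
    g (suc k) ∸ (g k + N) + (g k + N)                          ≡⟨ cong₂ _+_ (proj₂ (proj₂ (proj₂ distributed))) (trans (∑-suc-lastOr P) (+-comm N (g k))) ⟨
    ∑ ys proj₂ + ∑[ es ∈ parts ] suc (lastOr 0 es)             ≡⟨ cong (∑ ys proj₂ +_) (∑-parts (λ es → suc (lastOr 0 es))) ⟨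
    ∑ ys proj₂ + ∑[ y ∈ ys ] suc (lastOr 0 (proj₁ y))          ≡⟨ ∑-+ proj₂ (λ y → suc (lastOr 0 (proj₁ y))) ys ⟨
    ∑[ y ∈ ys ] (proj₂ y + suc (lastOr 0 (proj₁ y)))           ≡⟨ ∑-extend _ _ (λ {(es , _)} asc → nth-pad-snoc-top es _ (asc-length₀ es asc)) ⟨
    ∑[ es ∈ map extend ys ] nth (pad (suc (suc k)) es) (suc k) ∎
    where open ≡-Reasoning

parts-one : ∀ {N g} → N ≡⌈ g 0 / 1 ⌉ → Parts 1 N g
parts-one {N} {g} (g0≤ , <g0+1) = record
  { parts     = replicate N (1 ∷ [])
  ; ascending = All.replicate⁺ N (z<s , s≤s z≤n , tt)
  ; count     = length-replicate N
  ; sums      = λ { zero _ → trans g0≡N (sym (∑-replicate (λ es → nth (pad 1 es) 0) N (1 ∷ [])))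
                ; (suc p) (s≤s ()) }
  }
  where
  g0≡N : g 0 ≡ N * 1
  g0≡N = trans (≤-antisym (subst (g 0 ≤_) (*-identityˡ N) g0≤)
                          (≤-pred (subst (_< suc (g 0)) (*-identityˡ N) (subst (1 * N <_) (+-comm (g 0) 1) <g0+1))))
               (sym (*-identityʳ N))

-- N is the fewest parts that can carry g k, each contributing at most k + 1 to it;
-- keeping the count minimal is what keeps it below the rise g (k+1) − g k.
lh-parts : ∀ k {N g} → IsLectureHall (suc k) g → N ≡⌈ g k / suc k ⌉ → Parts (suc k) N g
lh-parts zero          lh N≡ = parts-one N≡
lh-parts (suc k) {N} {g} lh N≡ with ⌈/⌉-exists (g k) k
... | N′ , N′≡ = parts-extend (parts-pad (lh-parts k (lh-restrict lh) N′≡) N′≤N) low (proj₁ N≡)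
  where
  step : suc k < suc (suc k)
  step = ≤-refl
  N′≤N : N′ ≤ N
  N′≤N = ⌈/⌉-least N′≡ (lh-bound lh step (proj₁ N≡))
  low : g k + N ≤ g (suc k)
  low = subst (g k + N ≤_) (m+[n∸m]≡n (lh-mono lh step)) (+-monoʳ-≤ (g k) (⌈/⌉-least N≡ (lh-gapʳ lh step)))

decomposition : ∀ m {g} → IsLectureHall (suc m) g →
  Σ (List (List ℕ)) λ Es → All (Ascending 0 m) Es × (∀ p → p ≤ m → g p ≡ ∑[ es ∈ Es ] nth (gen m es) p)
decomposition zero {g} _ =
  replicate (g 0) [] , All.replicate⁺ (g 0) tt ,
  λ { zero _ → trans (sym (*-identityʳ (g 0))) (sym (∑-replicate (λ es → nth (gen 0 es) 0) (g 0) []))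
    ; (suc p) () }
decomposition (suc k) {g} lh with ⌈/⌉-exists (g k) k
... | N , N≡ = parts , ascending , sums′
  where
  step : suc k < suc (suc k)
  step = ≤-refl
  -- every v_A has rise exactly 1, so g needs rise (suc k) g generators
  P : Parts (suc k) (rise (suc k) g) g
  P = parts-pad (lh-parts k (lh-restrict lh) N≡) (⌈/⌉-least N≡ (lh-gapˡ lh step))
  open Parts P
  sums′ : ∀ p → p ≤ suc k → g p ≡ ∑[ es ∈ parts ] nth (gen (suc k) es) p
  sums′ p p≤ with m≤n⇒m<n∨m≡n p≤
  ... | inj₁ p<k = trans (sums p p<k) (sym (∑-cong (All.map (λ asc → nth-gen-< asc p<k) ascending)))
  ... | inj₂ refl = begin
    g (suc k)                                 ≡⟨ m∸n+n≡m (lh-mono lh step) ⟨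
    rise (suc k) g + g k                      ≡⟨ ∑-suc-lastOr P ⟨
    ∑[ es ∈ parts ] suc (lastOr 0 es)         ≡⟨ ∑-cong (All.map nth-gen-top ascending) ⟨
    ∑[ es ∈ parts ] nth (gen (suc k) es) (suc k) ∎
    where open ≡-Reasoning

-- The generators lie in the cone

-- the lecture hall inequalities for xs placed at positions q, q + 1, …
LectureHallFrom : ℕ → List ℕ → Set
LectureHallFrom q []           = ⊤
LectureHallFrom q (x ∷ [])     = ⊤
LectureHallFrom q (x ∷ y ∷ ys) = suc (suc q) * x ≤ suc q * y × LectureHallFrom (suc q) (y ∷ ys)

lhf-ratio-≤ : ∀ q xs → LectureHallFrom q xs → ∀ p → suc p < length xs →
  suc (suc (q + p)) * nth xs p ≤ suc (q + p) * nth xs (suc p)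
lhf-ratio-≤ q (x ∷ [])     _       p       (s≤s ())
lhf-ratio-≤ q (x ∷ y ∷ ys) (h , _) zero    _         = subst (λ r → suc (suc r) * x ≤ suc r * y) (sym (+-identityʳ q)) h
lhf-ratio-≤ q (x ∷ y ∷ ys) (_ , h) (suc p) (s≤s p<) =
  subst (λ r → suc (suc r) * nth (y ∷ ys) p ≤ suc r * nth (y ∷ ys) (suc p)) (sym (+-suc q p)) (lhf-ratio-≤ (suc q) (y ∷ ys) h p p<)

lhf⇒lh : ∀ xs → LectureHallFrom 0 xs → IsLectureHall (length xs) (nth xs)
lhf⇒lh xs h .ratio-≤ = lhf-ratio-≤ 0 xs h

lhf-zeros : ∀ r q t → LectureHallFrom (r + q) t → LectureHallFrom q (replicate r 0 ++ t)
lhf-zeros zero    q t h = h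
lhf-zeros (suc r) q t h with replicate r 0 ++ t | lhf-zeros r (suc q) t (subst (λ s → LectureHallFrom s t) (sym (+-suc r q)) h)
... | []     | _  = tt
... | y ∷ ys | h′ = subst (_≤ suc q * y) (sym (*-zeroʳ (suc (suc q)))) z≤n , h′

lh-criterion : ∀ {q x y} → x ≤ suc q → x < y → suc (suc q) * x ≤ suc q * y
lh-criterion {q} {x} {y} x≤ x<y = begin
  suc (suc q) * x     ≡⟨ +-comm x (suc q * x) ⟩
  suc q * x + x       ≤⟨ +-monoʳ-≤ (suc q * x) x≤ ⟩
  suc q * x + suc q   ≡⟨ +-comm (suc q * x) (suc q) ⟩
  suc q + suc q * x   ≡⟨ *-suc (suc q) x ⟨
  suc q * suc x       ≤⟨ *-monoʳ-≤ (suc q) x<y ⟩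
  suc q * y           ∎
  where open ≤-Reasoning

lhf-ascending : ∀ q x xs {B} → Ascending x B xs → lastOr x xs ≤ suc (q + length xs) → LectureHallFrom q (x ∷ xs)
lhf-ascending q x []       _                 _ = tt
lhf-ascending q x (y ∷ ys) asc@(x<y , _ , asc′) lst≤ =
  lh-criterion x≤ x<y ,
  lhf-ascending (suc q) y ys asc′ (subst (lastOr y ys ≤_) (cong suc (+-suc q (length ys))) lst≤)
  where
  x≤ : x ≤ suc q
  x≤ = +-cancelʳ-≤ (length (y ∷ ys)) x (suc q) (≤-trans (asc-lastOr-lower (y ∷ ys) asc) lst≤)

length-gen : ∀ m es → Ascending 0 m es → length (gen m es) ≡ suc m
length-gen m es asc = trans (cong length (gen≡pad m es)) (length-pad (es ++ _) (begin
  length (es ++ suc (lastOr 0 es) ∷ []) ≡⟨ length-++ es ⟩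
  length es + 1                          ≡⟨ +-comm (length es) 1 ⟩
  suc (length es)                        ≤⟨ s≤s (asc-length₀ es asc) ⟩
  suc m                                  ∎))
  where open ≤-Reasoning

gen-lh : ∀ m es → Ascending 0 m es → IsLectureHall (suc m) (nth (gen m es))
gen-lh m es asc = subst (λ n → IsLectureHall n (nth (gen m es))) (length-gen m es asc) (lhf⇒lh (gen m es) (lhf es asc))
  where
  lhf : ∀ es → Ascending 0 m es → LectureHallFrom 0 (gen m es)
  lhf []        _   = lhf-zeros m 0 (1 ∷ []) tt
  lhf (e ∷ es′) asc = lhf-zeros (m ∸ length (e ∷ es′)) 0 (e ∷ es′ ++ y ∷ []) (lhf-ascending _ e (es′ ++ y ∷ []) asc′ y≤)
    where
    y : ℕ
    y = suc (lastOr 0 (e ∷ es′))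
    last≤m : lastOr 0 (e ∷ es′) ≤ m
    last≤m = asc-lastOr (e ∷ es′) asc z≤n
    asc′ : Ascending e (suc m) (es′ ++ y ∷ [])
    asc′ = proj₂ (proj₂ (asc-snoc (e ∷ es′) (asc-mono-bound (e ∷ es′) (n≤1+n m) asc) ≤-refl (s≤s last≤m)))
    position : m ∸ length (e ∷ es′) + 0 + length (es′ ++ y ∷ []) ≡ m
    position = trans (cong₂ _+_ (+-identityʳ _) (trans (length-++ es′) (+-comm (length es′) 1)))
                     (m∸n+n≡m (asc-length₀ (e ∷ es′) asc))
    y≤ : lastOr e (es′ ++ y ∷ []) ≤ suc (m ∸ length (e ∷ es′) + 0 + length (es′ ++ y ∷ []))
    y≤ = subst₂ _≤_ (sym (lastOr-++ e es′ (y ∷ []))) (cong suc (sym position)) (s≤s last≤m)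

rise-gen : ∀ m es → Ascending 0 m es → rise m (nth (gen m es)) ≡ 1
rise-gen zero    []       _                = refl
rise-gen zero    (x ∷ _) (0<x , x≤0 , _) = ⊥-elim (<⇒≱ 0<x x≤0)
rise-gen (suc k) es asc = begin
  nth (gen (suc k) es) (suc k) ∸ nth (gen (suc k) es) k ≡⟨ cong₂ _∸_ (nth-gen-top asc) (nth-gen-< asc ≤-refl) ⟩
  suc (lastOr 0 es) ∸ nth (pad (suc k) es) k           ≡⟨ cong (suc (lastOr 0 es) ∸_) (nth-pad-last es (asc-length₀ es asc)) ⟩
  suc (lastOr 0 es) ∸ lastOr 0 es                      ≡⟨ m+n∸n≡m 1 (lastOr 0 es) ⟩
  1                                                    ∎
  where open ≡-Reasoning

-- Subsets, vectors and rationals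

elemsFrom-ascending : ∀ m j (A : Subset m) → Ascending j (j + m) (elemsFrom (suc j) A)
elemsFrom-ascending zero    j []          = tt
elemsFrom-ascending (suc m) j (true ∷ A)  =
  ≤-refl , subst (suc j ≤_) (sym (+-suc j m)) (s≤s (m≤m+n j m)) ,
  subst (λ B → Ascending (suc j) B (elemsFrom (suc (suc j)) A)) (sym (+-suc j m)) (elemsFrom-ascending m (suc j) A)
elemsFrom-ascending (suc m) j (false ∷ A) =
  asc-mono-lower (elemsFrom (suc (suc j)) A) (n≤1+n j)
    (subst (λ B → Ascending (suc j) B (elemsFrom (suc (suc j)) A)) (sym (+-suc j m)) (elemsFrom-ascending m (suc j) A))

ascending⇒elemsFrom : ∀ m j es → Ascending j (j + m) es → Σ (Subset m) λ A → elemsFrom (suc j) A ≡ es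
ascending⇒elemsFrom zero    j []       _                = [] , refl
ascending⇒elemsFrom zero    j (x ∷ es) (j<x , x≤j+0 , _) = ⊥-elim (<-irrefl refl (≤-trans j<x (subst (x ≤_) (+-identityʳ j) x≤j+0)))
ascending⇒elemsFrom (suc m) j []       _ with ascending⇒elemsFrom m (suc j) [] tt
... | A , eq = false ∷ A , eq
ascending⇒elemsFrom (suc m) j (x ∷ es) (j<x , x≤ , asc) with x ≟ suc j
... | yes refl with ascending⇒elemsFrom m (suc j) es (subst (λ B → Ascending (suc j) B es) (+-suc j m) asc)
...   | A , eq = true ∷ A , cong (suc j ∷_) eq
ascending⇒elemsFrom (suc m) j (x ∷ es) (j<x , x≤ , asc) | no x≢
  with ascending⇒elemsFrom m (suc j) (x ∷ es)
         (≤∧≢⇒< j<x (x≢ ∘ sym) , subst (x ≤_) (+-suc j m) x≤ , subst (λ B → Ascending x B es) (+-suc j m) asc)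
...   | A , eq = false ∷ A , eq

vec : ∀ {n} → (ℕ → ℕ) → Vec ℤ n
vec g = tabulate (λ i → ℤ.+ g (toℕ i))

lookup-vec : ∀ {n} g (i : Fin n) → lookup (vec g) i ≡ ℤ.+ g (toℕ i)
lookup-vec g = lookup∘tabulate (λ i → ℤ.+ g (toℕ i))

vec-cong : ∀ {n f g} → (∀ p → p < n → f p ≡ g p) → vec {n} f ≡ vec g
vec-cong eq = tabulate-cong (λ i → cong ℤ.+_ (eq (toℕ i) (toℕ<n i)))

vec-⊕ : ∀ {n} f g → vec {n} f ⊕ vec g ≡ vec (λ p → f p + g p)
vec-⊕ {zero}  f g = refl
vec-⊕ {suc n} f g = cong (ℤ.+ (f 0 + g 0) ∷_) (vec-⊕ {n} (f ∘ suc) (g ∘ suc))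

nthOr0-map-+ : ∀ xs p → nthOr0 (map ℤ.+_ xs) p ≡ ℤ.+ nth xs p
nthOr0-map-+ []       p       = refl
nthOr0-map-+ (x ∷ xs) zero    = refl
nthOr0-map-+ (x ∷ xs) (suc p) = nthOr0-map-+ xs p

vA≡vec-gen : ∀ {m} (A : Subset m) → vA A ≡ vec (nth (gen m (elems A)))
vA≡vec-gen {m} A = tabulate-cong (λ i → nthOr0-map-+ (gen m (elems A)) (toℕ i))

coord : ∀ {n} → Vec ℤ n → ℕ → ℤ
coord []       _       = ℤ.+ 0
coord (x ∷ xs) zero    = x
coord (x ∷ xs) (suc p) = coord xs p

lookup≡coord : ∀ {n} (v : Vec ℤ n) i → lookup v i ≡ coord v (toℕ i)
lookup≡coord (x ∷ xs) Fin.zero    = refl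
lookup≡coord (x ∷ xs) (Fin.suc i) = lookup≡coord xs i

/≤/⇒*≤* : ∀ a b i j → a ℚ./ suc i ℚ.≤ b ℚ./ suc j → a ℤ.* ℤ.+ suc j ℤ.≤ b ℤ.* ℤ.+ suc i
/≤/⇒*≤* a b i j le = ℚᵘ.drop-*≤* (ℚᵘ.≤-respʳ-≃ (ℚ.toℚᵘ-fromℚᵘ (ℚᵘ.mkℚᵘ b j))
  (ℚᵘ.≤-respˡ-≃ (ℚ.toℚᵘ-fromℚᵘ (ℚᵘ.mkℚᵘ a i)) (ℚ.toℚᵘ-mono-≤ le)))

*≤*⇒/≤/ : ∀ a b i j → a ℤ.* ℤ.+ suc j ℤ.≤ b ℤ.* ℤ.+ suc i → a ℚ./ suc i ℚ.≤ b ℚ./ suc j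
*≤*⇒/≤/ a b i j le = ℚ.toℚᵘ-cancel-≤ (ℚᵘ.≤-respʳ-≃ (ℚᵘ.≃-sym (ℚ.toℚᵘ-fromℚᵘ (ℚᵘ.mkℚᵘ b j)))
  (ℚᵘ.≤-respˡ-≃ (ℚᵘ.≃-sym (ℚ.toℚᵘ-fromℚᵘ (ℚᵘ.mkℚᵘ a i))) (ℚᵘ.*≤* le)))

+*≤+*⇒/≤/ : ∀ a b i j → a * suc j ≤ b * suc i → ℤ.+ a ℚ./ suc i ℚ.≤ ℤ.+ b ℚ./ suc j
+*≤+*⇒/≤/ a b i j le = *≤*⇒/≤/ (ℤ.+ a) (ℤ.+ b) i j (subst₂ ℤ._≤_ (ℤ.pos-* a (suc j)) (ℤ.pos-* b (suc i)) (ℤ.+≤+ le))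

ratio-vec : ∀ {n} g (i : Fin n) → ratio (vec g) i ≡ ℤ.+ g (toℕ i) ℚ./ suc (toℕ i)
ratio-vec g i = cong (λ x → x ℚ./ suc (toℕ i)) (lookup-vec g i)

vec∈LHpoint : ∀ m {g} → IsLectureHall (suc m) g → LHpoint (suc m) (vec g)
vec∈LHpoint m {g} lh = nonneg , ordered
  where
  nonneg : ∀ i → toℕ i ≡ 0 → ℚ.0ℚ ℚ.≤ ratio (vec g) i
  nonneg i _ = subst (ℚ.0ℚ ℚ.≤_) (sym (ratio-vec g i)) (+*≤+*⇒/≤/ 0 (g (toℕ i)) 0 (toℕ i) z≤n)
  ordered : ∀ i j → toℕ j ≡ suc (toℕ i) → ratio (vec g) i ℚ.≤ ratio (vec g) j
  ordered i j j≡ rewrite ratio-vec g i | ratio-vec g j | j≡ =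
    +*≤+*⇒/≤/ (g (toℕ i)) (g (suc (toℕ i))) (toℕ i) (suc (toℕ i))
      (subst₂ _≤_ (*-comm (suc (suc (toℕ i))) (g (toℕ i))) (*-comm (suc (toℕ i)) (g (suc (toℕ i))))
        (ratio-≤ lh (toℕ i) (subst (_< suc m) j≡ (toℕ<n j))))

nonneg-step : ∀ {a b} p → ℤ.+ 0 ℤ.≤ a → a ℤ.* ℤ.+ suc (suc p) ℤ.≤ b ℤ.* ℤ.+ suc p → ℤ.+ 0 ℤ.≤ b
nonneg-step {ℤ.+ k} {b} p _ le =
  ℤ.*-cancelʳ-≤-pos (ℤ.+ 0) b (ℤ.+ suc p) (ℤ.≤-trans (subst (ℤ.+ 0 ℤ.≤_) (ℤ.pos-* k _) (ℤ.+≤+ z≤n)) le)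

module _ (m : ℕ) {v : Vec ℤ (suc m)} (v∈L : LHpoint (suc m) v) where

  LHpoint⇒cross : ∀ p → suc p < suc m → coord v p ℤ.* ℤ.+ suc (suc p) ℤ.≤ coord v (suc p) ℤ.* ℤ.+ suc p
  LHpoint⇒cross p p< = subst₂ ℤ._≤_
    (cong₂ (λ y n → y ℤ.* ℤ.+ suc n) (trans (lookup≡coord v i) (cong (coord v) ti)) tj)
    (cong₂ (λ y n → y ℤ.* ℤ.+ suc n) (trans (lookup≡coord v j) (cong (coord v) tj)) ti)
    (/≤/⇒*≤* (lookup v i) (lookup v j) (toℕ i) (toℕ j) (proj₂ v∈L i j (trans tj (cong suc (sym ti)))))
    where
    i j : Fin (suc m)
    i = fromℕ< (<⇒≤ p<)
    j = fromℕ< p<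
    ti : toℕ i ≡ p
    ti = toℕ-fromℕ< (<⇒≤ p<)
    tj : toℕ j ≡ suc p
    tj = toℕ-fromℕ< p<

  LHpoint⇒nonneg : ∀ p → p < suc m → ℤ.+ 0 ℤ.≤ coord v p
  LHpoint⇒nonneg zero    _  = subst (ℤ.+ 0 ℤ.≤_) (trans (ℤ.*-identityʳ (lookup v Fin.zero)) (lookup≡coord v Fin.zero))
    (/≤/⇒*≤* (ℤ.+ 0) (lookup v Fin.zero) 0 0 (proj₁ v∈L Fin.zero refl))
  LHpoint⇒nonneg (suc p) p< = nonneg-step p (LHpoint⇒nonneg p (<⇒≤ p<)) (LHpoint⇒cross p p<)

  LHpoint⇒vec : Σ (ℕ → ℕ) λ g → v ≡ vec g × IsLectureHall (suc m) g
  LHpoint⇒vec = g , v≡vec , lh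
    where
    g : ℕ → ℕ
    g p = ℤ.∣ coord v p ∣

    coord≡ : ∀ p → p < suc m → coord v p ≡ ℤ.+ g p
    coord≡ p p< = sym (ℤ.0≤i⇒+∣i∣≡i (LHpoint⇒nonneg p p<))

    v≡vec : v ≡ vec g
    v≡vec = trans (sym (tabulate∘lookup v)) (tabulate-cong (λ i → trans (lookup≡coord v i) (coord≡ (toℕ i) (toℕ<n i))))

    lh : IsLectureHall (suc m) g
    lh .ratio-≤ p p< = subst₂ _≤_ (*-comm (g p) (suc (suc p))) (*-comm (g (suc p)) (suc p)) (ℤ.drop‿+≤+ (subst₂ ℤ._≤_
      (trans (cong (ℤ._* ℤ.+ suc (suc p)) (coord≡ p (<⇒≤ p<))) (sym (ℤ.pos-* (g p) (suc (suc p)))))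
      (trans (cong (ℤ._* ℤ.+ suc p) (coord≡ (suc p) p<)) (sym (ℤ.pos-* (g (suc p)) (suc p))))
      (LHpoint⇒cross p p<)))

vec-∑-gen∈Gen : ∀ {m} Es → All (Ascending 0 m) Es → Gen (Hset m) (vec {suc m} (λ p → ∑[ es ∈ Es ] nth (gen m es) p))
vec-∑-gen∈Gen          []        []           = gen-zero
vec-∑-gen∈Gen {m} (es ∷ Es) (asc ∷ ascs) with ascending⇒elemsFrom m 0 es asc
... | A , refl = subst (Gen (Hset m)) (vec-⊕ (nth (gen m es)) (λ p → ∑[ es′ ∈ Es ] nth (gen m es′) p))
                       (gen-add (A , sym (vA≡vec-gen A)) (vec-∑-gen∈Gen Es ascs))

LHpoint⊆Gen : ∀ m → LHpoint (suc m) ⊆ Gen (Hset m)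
LHpoint⊆Gen m {v} v∈L with LHpoint⇒vec m {v} v∈L
... | g , v≡ , lh with decomposition m lh
...   | Es , ascs , sums =
  subst (Gen (Hset m)) (trans (vec-cong {g = g} (λ p p< → sym (sums p (≤-pred p<)))) (sym v≡)) (vec-∑-gen∈Gen Es ascs)

Hset⊆LHpoint : ∀ m → Hset m ⊆ LHpoint (suc m)
Hset⊆LHpoint m (A , refl) = subst (LHpoint (suc m)) (sym (vA≡vec-gen A)) (vec∈LHpoint m (gen-lh m (elems A) (elemsFrom-ascending m 0 A)))

-- Irreducibility of the generators

⊕-identityˡ : ∀ {n} (w : Vec ℤ n) → zeroV ⊕ w ≡ w
⊕-identityˡ []      = refl
⊕-identityˡ (x ∷ w) = cong₂ _∷_ (ℤ.+-identityˡ x) (⊕-identityˡ w)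

⊕-identityʳ : ∀ {n} (w : Vec ℤ n) → w ⊕ zeroV ≡ w
⊕-identityʳ []      = refl
⊕-identityʳ (x ∷ w) = cong₂ _∷_ (ℤ.+-identityʳ x) (⊕-identityʳ w)

nonneg-+≡0 : ∀ {a b} → ℤ.+ 0 ℤ.≤ a → ℤ.+ 0 ℤ.≤ b → a ℤ.+ b ≡ ℤ.+ 0 → a ≡ ℤ.+ 0 × b ≡ ℤ.+ 0
nonneg-+≡0 {ℤ.+ zero}  {ℤ.+ zero} _ _ _ = refl , refl

nonneg-+≡1 : ∀ {a b} → ℤ.+ 0 ℤ.≤ a → ℤ.+ 0 ℤ.≤ b → a ℤ.+ b ≡ ℤ.+ 1 →
  (a ≡ ℤ.+ 0 × b ≡ ℤ.+ 1) ⊎ (a ≡ ℤ.+ 1 × b ≡ ℤ.+ 0)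
nonneg-+≡1 {ℤ.+ zero}     {ℤ.+ .1}   _ _ refl = inj₁ (refl , refl)
nonneg-+≡1 {ℤ.+ suc zero} {ℤ.+ zero} _ _ _    = inj₂ (refl , refl)

module _ {n} {S : Pred (Vec ℤ n) 0ℓ} (φ : Vec ℤ n → ℤ)
  (φ-⊕ : ∀ u w → φ (u ⊕ w) ≡ φ u ℤ.+ φ w) (φ-zeroV : φ zeroV ≡ ℤ.+ 0)
  (φ-nonneg : ∀ {v} → S v → ℤ.+ 0 ℤ.≤ φ v) (φ-definite : ∀ {v} → S v → φ v ≡ ℤ.+ 0 → v ≡ zeroV)
  {H : Pred (Vec ℤ n) 0ℓ} (H⊆S : H ⊆ S) where

  Gen-nonneg : ∀ {v} → Gen H v → ℤ.+ 0 ℤ.≤ φ v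
  Gen-nonneg gen-zero = subst (ℤ.+ 0 ℤ.≤_) (sym φ-zeroV) (ℤ.+≤+ z≤n)
  Gen-nonneg (gen-add {h} {w} h∈H w∈G) = subst (ℤ.+ 0 ℤ.≤_) (sym (φ-⊕ h w)) (ℤ.+-mono-≤ (φ-nonneg (H⊆S h∈H)) (Gen-nonneg w∈G))

  Gen-definite : ∀ {v} → Gen H v → φ v ≡ ℤ.+ 0 → v ≡ zeroV
  Gen-definite gen-zero                      _   = refl
  Gen-definite (gen-add {h} {w} h∈H w∈G) φ≡0
    with nonneg-+≡0 (φ-nonneg (H⊆S h∈H)) (Gen-nonneg w∈G) (trans (sym (φ-⊕ h w)) φ≡0)
  ... | φh≡0 , φw≡0 = trans (cong₂ _⊕_ (φ-definite (H⊆S h∈H) φh≡0) (Gen-definite w∈G φw≡0)) (⊕-identityˡ zeroV)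

  Gen-unit : ∀ {v} → Gen H v → φ v ≡ ℤ.+ 1 → H v
  Gen-unit gen-zero φ≡1 with trans (sym φ-zeroV) φ≡1
  ... | ()
  Gen-unit (gen-add {h} {w} h∈H w∈G) φ≡1
    with nonneg-+≡1 (φ-nonneg (H⊆S h∈H)) (Gen-nonneg w∈G) (trans (sym (φ-⊕ h w)) φ≡1)
  ... | inj₁ (φh≡0 , φw≡1) = subst H (sym (trans (cong (_⊕ w) (φ-definite (H⊆S h∈H) φh≡0)) (⊕-identityˡ w))) (Gen-unit w∈G φw≡1)
  ... | inj₂ (φh≡1 , φw≡0) = subst H (sym (trans (cong (h ⊕_) (Gen-definite w∈G φw≡0)) (⊕-identityʳ h))) h∈H

height : ∀ {m} → Vec ℤ (suc m) → ℤ
height (x ∷ [])        = x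
height (x ∷ y ∷ [])    = y ℤ.- x
height (x ∷ y ∷ z ∷ v) = height (y ∷ z ∷ v)

height-⊕ : ∀ {m} (u w : Vec ℤ (suc m)) → height (u ⊕ w) ≡ height u ℤ.+ height w
height-⊕ (x ∷ [])        (x′ ∷ [])          = refl
height-⊕ (x ∷ y ∷ [])    (x′ ∷ y′ ∷ [])     = -‿interchange y y′ x x′
  where
  -‿interchange : ∀ a b c d → (a ℤ.+ b) ℤ.- (c ℤ.+ d) ≡ (a ℤ.- c) ℤ.+ (b ℤ.- d)
  -‿interchange = ℤSolver.solve-∀
height-⊕ (x ∷ y ∷ z ∷ u) (x′ ∷ y′ ∷ z′ ∷ w) = height-⊕ (y ∷ z ∷ u) (y′ ∷ z′ ∷ w)

height-zeroV : ∀ {m} → height (zeroV {suc m}) ≡ ℤ.+ 0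
height-zeroV {zero}        = refl
height-zeroV {suc zero}    = refl
height-zeroV {suc (suc m)} = height-zeroV {suc m}

height-vec : ∀ m {g} → IsLectureHall (suc m) g → height (vec {suc m} g) ≡ ℤ.+ rise m g
height-vec zero    lh = refl
height-vec (suc k) {g} lh = go k g (lh-mono lh ≤-refl)
  where
  go : ∀ k g → g k ≤ g (suc k) → height (vec {suc (suc k)} g) ≡ ℤ.+ (g (suc k) ∸ g k)
  go zero    g le = trans (ℤ.m-n≡m⊖n (g 1) (g 0)) (ℤ.⊖-≥ le)
  go (suc k) g le = go k (g ∘ suc) le

rise≡0⇒vec≡zeroV : ∀ m {g} → IsLectureHall (suc m) g → rise m g ≡ 0 → vec {suc m} g ≡ zeroV
rise≡0⇒vec≡zeroV m {g} lh r≡0 =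
  vec-cong (λ p p< → n≤0⇒n≡0 (subst (g p ≤_) (rise≡0⇒top≡0 m lh r≡0) (lh-monotone lh (≤-pred p<) ≤-refl)))

module _ (m : ℕ) where

  height-nonneg : ∀ {v} → LHpoint (suc m) v → ℤ.+ 0 ℤ.≤ height v
  height-nonneg {v} v∈L with LHpoint⇒vec m {v} v∈L
  ... | g , v≡ , lh = subst (ℤ.+ 0 ℤ.≤_) (sym (trans (cong (height {m}) v≡) (height-vec m lh))) (ℤ.+≤+ z≤n)

  height-definite : ∀ {v} → LHpoint (suc m) v → height v ≡ ℤ.+ 0 → v ≡ zeroV
  height-definite {v} v∈L h≡0 with LHpoint⇒vec m {v} v∈L
  ... | g , v≡ , lh = trans v≡ (rise≡0⇒vec≡zeroV m lh
                        (ℤ.+-injective (trans (sym (height-vec m lh)) (trans (cong (height {m}) (sym v≡)) h≡0))))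

  height-vA : ∀ (A : Subset m) → height (vA A) ≡ ℤ.+ 1
  height-vA A = begin
    height (vA A)                        ≡⟨ cong (height {m}) (vA≡vec-gen A) ⟩
    height (vec {suc m} (nth (gen m (elems A)))) ≡⟨ height-vec m (gen-lh m (elems A) asc) ⟩
    ℤ.+ rise m (nth (gen m (elems A)))   ≡⟨ cong ℤ.+_ (rise-gen m (elems A) asc) ⟩
    ℤ.+ 1                                ∎
    where
    open ≡-Reasoning
    asc : Ascending 0 m (elems A)
    asc = elemsFrom-ascending m 0 A

  Hset-generates : IsGeneratingSet (LHpoint (suc m)) (Hset m)
  Hset-generates = Hset⊆LHpoint m , LHpoint⊆Gen m

  Hset⊆generators : ∀ {G} → IsGeneratingSet (LHpoint (suc m)) G → Hset m ⊆ G
  Hset⊆generators (G⊆L , L⊆G) v∈H@(A , refl) =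
    Gen-unit {S = LHpoint (suc m)} height height-⊕ (height-zeroV {m})
      (λ {v} → height-nonneg {v}) (λ {v} → height-definite {v}) G⊆L
      (L⊆G (Hset⊆LHpoint m {vA A} v∈H)) (height-vA A)

theorem6 : (m : ℕ) →
    IsMinimalGeneratingSet (LHpoint (suc m)) (Hset m) ×
    (∀ H → IsMinimalGeneratingSet (LHpoint (suc m)) H → (H ⊆ Hset m) × (Hset m ⊆ H))
theorem6 m = (Hset-generates m , λ _ _ → Hset⊆generators m) ,
             λ H (H-generates , H-minimal) →
               H-minimal (Hset m) (Hset⊆generators m H-generates) (Hset-generates m) , Hset⊆generators m H-generates
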